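{- Let $\Phi_f=(G,F^\times,\varphi,f)$ be a skew gain graph where $G=K_{1,n}$ is a star of order $n+1$. Then the Laplacian spectrum of $\Phi_f$ consists of $\frac{n+1+\sqrt{(n+1)^2-4\det(L(\Phi_f))}}{2}$ with multiplicity $1$, $\frac{n+1-\sqrt{(n+1)^2-4\det(L(\Phi_f))}}{2}$ with multiplicity $1$, and $1$ with multiplicity $n-1$.
   Context: $F$ is a field of characteristic zero; $f:F^\times\to F^\times$ is an involutive automorphism. A skew gain graph $\Phi_f=(G,F^\times,\varphi,f)$ on an edge-oriented simple graph $G$ assigns to each oriented edge a gain $\varphi(\overrightarrow{uv})\in F^\times$ with $\varphi(\overrightarrow{vu})=f(\varphi(\overrightarrow{uv}))$. Its adjacency matrix $A(\Phi_f)=(a_{ij})$ has $a_{ij}=\varphi(\overrightarrow{v_iv_j})$ if $v_i\sim v_j$, else $0$. $d(v)\in F$ is the degree of $v$ viewed in $F$, $D(\Phi_f)=\mathrm{diag}(d(v_i))$, and $L(\Phi_f)=D(\Phi_f)-A(\Phi_f)$. The Laplacian spectrum is the multiset of eigenvalues of $L(\Phi_f)$ in an algebraic closure of $F$; $\sqrt{\cdot}$ denotes a square root there. -}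

module Defs where

open import Level using (Level; _⊔_) renaming (suc to lsuc)
open import Data.Nat using (ℕ; zero; suc)
open import Data.Fin using (Fin; zero; suc; toℕ; punchIn; _≟_)
open import Data.List using (List; []; _∷_; replicate)
open import Data.Product using (Σ; _,_; proj₁; ∃)
open import Data.Unit using (⊤; tt)
open import Data.Empty using (⊥)
open import Relation.Nullary using (¬_; Dec; yes; no)
open import Relation.Binary using (Decidable)
open import Algebra.Bundles using (CommutativeRing)
open import Algebra.Morphism.Structures using (module RingMorphisms)

record IsField {c ℓ} (R : CommutativeRing c ℓ) : Set (c ⊔ ℓ) where
  open CommutativeRing R
  field
    0≉1     : ¬ (0# ≈ 1#)
    inverse : ∀ x → ¬ (x ≈ 0#) → Σ Carrier (λ y → x * y ≈ 1#)

record Field c ℓ : Set (lsuc (c ⊔ ℓ)) where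
  field
    commRing : CommutativeRing c ℓ
    isField  : IsField commRing
  open CommutativeRing commRing public

module RingOps {c ℓ} (R : CommutativeRing c ℓ) where
  open CommutativeRing R using (Carrier; _≈_; _+_; _*_; -_; _-_; 0#; 1#)

  fromℕ : ℕ → Carrier
  fromℕ zero    = 0#
  fromℕ (suc k) = 1# + fromℕ k

  Σᶠ : ∀ {n} → (Fin n → Carrier) → Carrier
  Σᶠ {zero}  f = 0#
  Σᶠ {suc n} f = f zero + Σᶠ (λ i → f (suc i))

  ∏ : List Carrier → Carrier
  ∏ []       = 1#
  ∏ (x ∷ xs) = x * ∏ xs

  _^_ : Carrier → ℕ → Carrier
  x ^ zero  = 1#
  x ^ suc k = x * (x ^ k)

  Matrix : ℕ → Set c
  Matrix n = Fin n → Fin n → Carrier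

  sign : ℕ → Carrier
  sign zero    = 1#
  sign (suc k) = - sign k

  det : ∀ {n} → Matrix n → Carrier
  det {zero}  M = 1#
  det {suc n} M =
    Σᶠ (λ j → sign (toℕ j) * M zero j * det (λ r s → M (suc r) (punchIn j s)))

  δ : ∀ {n} → Fin n → Fin n → Carrier
  δ i j with i ≟ j
  ... | yes _ = 1#
  ... | no  _ = 0#

  charPoly : ∀ {n} → Matrix n → Carrier → Carrier
  charPoly M x = det (λ i j → x * δ i j - M i j)

  -- the multiset (list) μs is the spectrum of M (eigenvalues with
  -- algebraic multiplicity): det(xI - M) = ∏_{μ ∈ μs} (x - μ) for all x
  IsSpectrum : ∀ {n} → Matrix n → List Carrier → Set (c ⊔ ℓ)
  IsSpectrum M μs = ∀ x → charPoly M x ≈ ∏ (mapSub μs x)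
    where
    mapSub : List Carrier → Carrier → List Carrier
    mapSub []       x = []
    mapSub (μ ∷ νs) x = (x - μ) ∷ mapSub νs x

  IsAlgClosed : Set (c ⊔ ℓ)
  IsAlgClosed = ∀ d (a : Fin (suc d) → Carrier) →
    ∃ λ x → (x ^ suc d) + Σᶠ (λ i → a i * (x ^ toℕ i)) ≈ 0#

CharZero : ∀ {c ℓ} → Field c ℓ → Set ℓ
CharZero F = ∀ k → ¬ (fromℕ (suc k) ≈ 0#)
  where open Field F using (_≈_; 0#; commRing); open RingOps commRing

-- Field extensions: a ring homomorphism F → K into an algebraically
-- closed field K (an algebraic closure of F contains such data)

record AlgClosedExtension {c ℓ} (F : Field c ℓ) c' ℓ' : Set (lsuc (c' ⊔ ℓ') ⊔ c ⊔ ℓ) where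
  field
    K        : Field c' ℓ'
    ι        : Field.Carrier F → Field.Carrier K
    ι-hom    : RingMorphisms.IsRingHomomorphism
                 (CommutativeRing.rawRing (Field.commRing F))
                 (CommutativeRing.rawRing (Field.commRing K)) ι
    isClosed : RingOps.IsAlgClosed (Field.commRing K)

module _ {c ℓ} (F : Field c ℓ) where
  open Field F using (Carrier; _≈_; _*_; 0#)

  Units : Set (c ⊔ ℓ)
  Units = Σ Carrier (λ x → ¬ (x ≈ 0#))

  record InvolutiveAut : Set (c ⊔ ℓ) where
    field
      fun   : Units → Units
      cong  : ∀ x y → proj₁ x ≈ proj₁ y → proj₁ (fun x) ≈ proj₁ (fun y)
      homo  : ∀ x y z → proj₁ z ≈ proj₁ x * proj₁ y →
              proj₁ (fun z) ≈ proj₁ (fun x) * proj₁ (fun y)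
      invol : ∀ x → proj₁ (fun (fun x)) ≈ proj₁ x

countDec : ∀ {k} {P : Fin k → Set} → ((j : Fin k) → Dec (P j)) → ℕ
countDec {zero}  d = 0
countDec {suc k} d with d zero
... | yes _ = suc (countDec (λ j → d (suc j)))
... | no  _ = countDec (λ j → d (suc j))

record SimpleGraph (m : ℕ) : Set₁ where
  field
    Adj     : Fin m → Fin m → Set
    adj?    : Decidable Adj
    symm    : ∀ {i j} → Adj i j → Adj j i
    irrefl  : ∀ i → ¬ Adj i i

  degree : Fin m → ℕ
  degree i = countDec (adj? i)

module _ {c ℓ} (F : Field c ℓ) where
  open Field F using (Carrier; _≈_; _+_; _*_; -_; _-_; 0#; 1#; commRing)
  open RingOps commRing

  record SkewGainGraph {m} (G : SimpleGraph m) (f : InvolutiveAut F) : Set (c ⊔ ℓ) where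
    open SimpleGraph G
    field
      gain : ∀ i j → Adj i j → Units F
      skew : ∀ i j (a : Adj i j) →
             proj₁ (gain j i (symm a)) ≈ proj₁ (InvolutiveAut.fun f (gain i j a))

    adjacency : Matrix m
    adjacency i j with adj? i j
    ... | yes a = proj₁ (gain i j a)
    ... | no  _ = 0#

    degreeMatrix : Matrix m
    degreeMatrix i j = fromℕ (degree i) * δ i j

    laplacian : Matrix m
    laplacian i j = degreeMatrix i j - adjacency i j

StarAdj : ∀ {n} → Fin (suc n) → Fin (suc n) → Set
StarAdj zero    zero    = ⊥
StarAdj zero    (suc _) = ⊤
StarAdj (suc _) zero    = ⊤
StarAdj (suc _) (suc _) = ⊥

star : ∀ n → SimpleGraph (suc n)
star n = record { Adj = StarAdj ; adj? = dec ; symm = sy ; irrefl = irr }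
  where
  dec : (i j : Fin (suc n)) → Dec (StarAdj i j)
  dec zero    zero    = no (λ ())
  dec zero    (suc _) = yes tt
  dec (suc _) zero    = yes tt
  dec (suc _) (suc _) = no (λ ())
  sy : ∀ {i j : Fin (suc n)} → StarAdj i j → StarAdj j i
  sy {zero}  {suc _} _ = tt
  sy {suc _} {zero}  _ = tt
  irr : (i : Fin (suc n)) → ¬ StarAdj i i
  irr zero    ()
  irr (suc _) ()

-- The Laplacian of a star with centre 0 is an arrowhead matrix: the centre's row and
-- column carry the gains, the degree n sits in the corner, and the block of the n leaves
-- is the identity.  Expanding det(xI − L) along the first row gives
-- (x − 1)^(n−1) ((x − n)(x − 1) − T) with T = Σⱼ φ(0,j) φ(j,0), and the same expansion
-- of det L gives n − T, so the quadratic factor is x² − (n + 1)x + det L, whose roots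
-- are given by the quadratic formula.
module Submission where

open import Defs
open import Level using (Level)
open import Data.Nat using (ℕ; suc; _∸_; _≤_; zero; z≤n; s≤s)
open import Data.List using (_∷_; replicate)
open import Data.Fin using (Fin; zero; suc; toℕ; punchIn; punchOut)
open import Data.Fin.Properties using (punchIn-punchOut; punchInᵢ≢i) renaming (_≟_ to _≟ᶠ_)
open import Data.Empty using (⊥-elim)
open import Data.Unit using (tt)
open import Relation.Nullary using (¬_; Dec; yes; no)
open import Relation.Binary.PropositionalEquality as ≡ using (_≡_; _≢_)
open import Algebra.Bundles using (CommutativeRing)
open import Algebra.Morphism.Structures using (module RingMorphisms)

countDec-all : ∀ {k} {P : Fin k → Set} (P? : ∀ j → Dec (P j)) → (∀ j → P j) → countDec P? ≡ k
countDec-all {zero}  P? all = ≡.refl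
countDec-all {suc k} P? all with P? zero
... | yes _   = ≡.cong suc (countDec-all (λ j → P? (suc j)) (λ j → all (suc j)))
... | no  ¬p  = ⊥-elim (¬p (all zero))

countDec-none : ∀ {k} {P : Fin k → Set} (P? : ∀ j → Dec (P j)) → (∀ j → ¬ P j) → countDec P? ≡ 0
countDec-none {zero}  P? none = ≡.refl
countDec-none {suc k} P? none with P? zero
... | yes p = ⊥-elim (none zero p)
... | no  _ = countDec-none (λ j → P? (suc j)) (λ j → none (suc j))

module Quadratic {c ℓ} (R : CommutativeRing c ℓ) where
  open CommutativeRing R hiding (zero)
  open RingOps R using (fromℕ)
  open import Algebra.Properties.Ring ring using (-‿distribˡ-*; -‿distribʳ-*; -‿involutive)
  open import Algebra.Properties.AbelianGroup +-abelianGroup using (⁻¹-∙-comm; ⁻¹-anti-homo‿-; xyx⁻¹≈y)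
  -- A semiring solver: negated terms are handed to it as independent variables.
  open import Algebra.Solver.Ring.NaturalCoefficients.Default commutativeSemiring
    using (solve; _:=_; _:+_; _:*_; con)
  open import Relation.Binary.Reasoning.Setoid setoid

  -x*-y≈x*y : ∀ x y → - x * - y ≈ x * y
  -x*-y≈x*y x y = begin
    - x * - y     ≈⟨ -‿distribˡ-* x (- y) ⟨
    - (x * - y)   ≈⟨ -‿cong (-‿distribʳ-* x y) ⟨
    - - (x * y)   ≈⟨ -‿involutive (x * y) ⟩
    x * y         ∎

  x-[x-y]≈y : ∀ x y → x - (x - y) ≈ y
  x-[x-y]≈y x y = begin
    x + - (x - y)  ≈⟨ +-congˡ (⁻¹-anti-homo‿- x y) ⟩
    x + (y - x)    ≈⟨ +-assoc x y (- x) ⟨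
    x + y - x      ≈⟨ xyx⁻¹≈y x y ⟩
    y              ∎

  vieta : ∀ {x a b σ π} → a + b ≈ σ → a * b ≈ π → (x - a) * (x - b) ≈ x * x - σ * x + π
  vieta {x} {a} {b} {σ} {π} a+b≈σ ab≈π = begin
    (x + - a) * (x + - b)            ≈⟨ expand x (- a) (- b) ⟩
    x * x + (- a + - b) * x + - a * - b
      ≈⟨ +-cong (+-congˡ (*-congʳ (trans (⁻¹-∙-comm a b) (-‿cong a+b≈σ))))
                (trans (-x*-y≈x*y a b) ab≈π) ⟩
    x * x + - σ * x + π              ≈⟨ +-congʳ (+-congˡ (-‿distribˡ-* σ x)) ⟨
    x * x - σ * x + π                ∎
    where
    expand : ∀ x A B → (x + A) * (x + B) ≈ x * x + (A + B) * x + A * B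
    expand = solve 3 (λ x A B → (x :+ A) :* (x :+ B) := x :* x :+ (A :+ B) :* x :+ A :* B) refl

  quadratic-splits : ∀ {x N D s h} → s * s ≈ N * N - fromℕ 4 * D → h * (1# + 1#) ≈ 1# →
                     x * x - N * x + D ≈ (x - (N + s) * h) * (x - (N - s) * h)
  quadratic-splits {x} {N} {D} {s} {h} s²≈disc h+h≈1 = sym (vieta sum≈N product≈D)
    where
    s-s≈0 : s - s ≈ 0#
    s-s≈0 = -‿inverseʳ s

    sum≈N : (N + s) * h + (N - s) * h ≈ N
    sum≈N = begin
      (N + s) * h + (N + - s) * h   ≈⟨ collect N s (- s) h ⟩
      N * (h * (1# + 1#)) + (s - s) * h
        ≈⟨ +-cong (*-congˡ h+h≈1) (trans (*-congʳ s-s≈0) (zeroˡ h)) ⟩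
      N * 1# + 0#                   ≈⟨ trans (+-identityʳ _) (*-identityʳ N) ⟩
      N                             ∎
      where
      collect : ∀ N s t h → (N + s) * h + (N + t) * h ≈ N * (h * (1# + 1#)) + (s + t) * h
      collect = solve 4 (λ N s t h → (N :+ s) :* h :+ (N :+ t) :* h
                                   := N :* (h :* (con 1 :+ con 1)) :+ (s :+ t) :* h) refl

    product≈D : (N + s) * h * ((N - s) * h) ≈ D
    product≈D = begin
      (N + s) * h * ((N + - s) * h)           ≈⟨ multiply N s (- s) h ⟩
      (N * N + s * - s + N * (s - s)) * (h * h)
        ≈⟨ *-congʳ (trans (+-cong (+-congˡ (sym (-‿distribʳ-* s s))) (trans (*-congˡ s-s≈0) (zeroʳ N)))
                          (+-identityʳ _)) ⟩
      (N * N - s * s) * (h * h)               ≈⟨ *-congʳ (trans (+-congˡ (-‿cong s²≈disc)) (x-[x-y]≈y _ _)) ⟩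
      fromℕ 4 * D * (h * h)                   ≈⟨ quarter D h ⟩
      D * ((h * (1# + 1#)) * (h * (1# + 1#))) ≈⟨ *-congˡ (trans (*-cong h+h≈1 h+h≈1) (*-identityˡ 1#)) ⟩
      D * 1#                                  ≈⟨ *-identityʳ D ⟩
      D                                       ∎
      where
      multiply : ∀ N s t h → (N + s) * h * ((N + t) * h) ≈ (N * N + s * t + N * (s + t)) * (h * h)
      multiply = solve 4 (λ N s t h → (N :+ s) :* h :* ((N :+ t) :* h)
                                    := (N :* N :+ s :* t :+ N :* (s :+ t)) :* (h :* h)) refl
      quarter : ∀ D h → fromℕ 4 * D * (h * h) ≈ D * ((h * (1# + 1#)) * (h * (1# + 1#)))
      quarter = solve 2 (λ D h → (con 1 :+ (con 1 :+ (con 1 :+ (con 1 :+ con 0)))) :* D :* (h :* h)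
                               := D :* ((h :* (con 1 :+ con 1)) :* (h :* (con 1 :+ con 1)))) refl

module Determinant {c ℓ} (R : CommutativeRing c ℓ) where
  open CommutativeRing R hiding (zero)
  open RingOps R
  open Quadratic R using (-x*-y≈x*y)
  open import Algebra.Properties.Ring ring using (-‿distribˡ-*; -1*x≈-x; [y-z]x≈yx-zx)
  open import Algebra.Properties.Semiring.Sum semiring
    using (sum; sum-cong-≋; sum-remove; sum-replicate-zero; *-distribˡ-sum)
  open import Algebra.Solver.Ring.NaturalCoefficients.Default commutativeSemiring
    using (solve; _:=_; _:*_)
  open import Relation.Binary.Reasoning.Setoid setoid

  Σᶠ≡sum : ∀ {n} (f : Fin n → Carrier) → Σᶠ f ≡ sum f
  Σᶠ≡sum {zero}  f = ≡.refl
  Σᶠ≡sum {suc n} f = ≡.cong (f zero +_) (Σᶠ≡sum (λ i → f (suc i)))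

  sum-zero : ∀ {n} {f : Fin n → Carrier} → (∀ i → f i ≈ 0#) → sum f ≈ 0#
  sum-zero {n} f≈0 = trans (sum-cong-≋ f≈0) (sum-replicate-zero n)

  sum-single : ∀ {n} {f : Fin (suc n) → Carrier} k → (∀ j → j ≢ k → f j ≈ 0#) → sum f ≈ f k
  sum-single {f = f} k f≈0 = begin
    sum f                               ≈⟨ sum-remove {i = k} f ⟩
    f k + sum (λ i → f (punchIn k i))   ≈⟨ +-congˡ (sum-zero (λ i → f≈0 _ (punchInᵢ≢i k i))) ⟩
    f k + 0#                            ≈⟨ +-identityʳ (f k) ⟩
    f k                                 ∎

  sign-square : ∀ k → sign k * sign k ≈ 1#
  sign-square zero    = *-identityˡ 1#
  sign-square (suc k) = trans (-x*-y≈x*y (sign k) (sign k)) (sign-square k)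

  sign-suc-*-sign : ∀ k a b → sign (suc k) * a * (sign k * b) ≈ - (a * b)
  sign-suc-*-sign k a b = begin
    - S * a * (S * b)     ≈⟨ *-congʳ (-‿distribˡ-* S a) ⟨
    - (S * a) * (S * b)   ≈⟨ -‿distribˡ-* (S * a) (S * b) ⟨
    - (S * a * (S * b))   ≈⟨ -‿cong (regroup S a b) ⟩
    - (S * S * (a * b))   ≈⟨ -‿cong (trans (*-congʳ (sign-square k)) (*-identityˡ (a * b))) ⟩
    - (a * b)             ∎
    where
    S = sign k
    regroup : ∀ S a b → S * a * (S * b) ≈ S * S * (a * b)
    regroup = solve 3 (λ S a b → S :* a :* (S :* b) := S :* S :* (a :* b)) refl

  1#^n≈1# : ∀ n → 1# ^ n ≈ 1#
  1#^n≈1# zero    = refl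
  1#^n≈1# (suc n) = trans (*-identityˡ (1# ^ n)) (1#^n≈1# n)

  δ-suc : ∀ {n} (i j : Fin n) → δ (suc i) (suc j) ≡ δ i j
  δ-suc i j with i ≟ᶠ j
  ... | yes _ = ≡.refl
  ... | no  _ = ≡.refl

  minor : ∀ {n} → Matrix (suc n) → Fin (suc n) → Matrix n
  minor M j r s = M (suc r) (punchIn j s)

  laplaceTerm : ∀ {n} → Matrix (suc n) → Fin (suc n) → Carrier
  laplaceTerm M j = sign (toℕ j) * M zero j * det (minor M j)

  det-expand : ∀ {n} (M : Matrix (suc n)) → det M ≈ sum (laplaceTerm M)
  det-expand M = reflexive (Σᶠ≡sum (laplaceTerm M))

  laplaceTerm-zeroEntry : ∀ {n} (M : Matrix (suc n)) j → M zero j ≈ 0# → laplaceTerm M j ≈ 0#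
  laplaceTerm-zeroEntry M j entry≈0 = trans (*-congʳ (trans (*-congˡ entry≈0) (zeroʳ _))) (zeroˡ _)

  laplaceTerm-zeroMinor : ∀ {n} (M : Matrix (suc n)) j → det (minor M j) ≈ 0# → laplaceTerm M j ≈ 0#
  laplaceTerm-zeroMinor M j minor≈0 = trans (*-congˡ minor≈0) (zeroʳ _)

  det-cong : ∀ {n} {M N : Matrix n} → (∀ i j → M i j ≈ N i j) → det M ≈ det N
  det-cong {zero}  M≈N = refl
  det-cong {suc n} {M} {N} M≈N = begin
    det M                ≈⟨ det-expand M ⟩
    sum (laplaceTerm M)  ≈⟨ sum-cong-≋ (λ j → *-cong (*-congˡ {sign (toℕ j)} (M≈N zero j))
                                                     (det-cong (λ r s → M≈N (suc r) (punchIn j s)))) ⟩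
    sum (laplaceTerm N)  ≈⟨ det-expand N ⟨
    det N                ∎

  det-zeroColumn : ∀ {n} (M : Matrix n) k → (∀ r → M r k ≈ 0#) → det M ≈ 0#
  det-zeroColumn {suc n} M k column≈0 = trans (det-expand M) (sum-zero term≈0)
    where
    term≈0 : ∀ j → laplaceTerm M j ≈ 0#
    term≈0 j with j ≟ᶠ k
    ... | yes ≡.refl = laplaceTerm-zeroEntry M j (column≈0 zero)
    ... | no  j≢k    = laplaceTerm-zeroMinor M j (det-zeroColumn (minor M j) (punchOut j≢k)
      (λ r → ≡.subst (λ t → M (suc r) t ≈ 0#) (≡.sym (punchIn-punchOut j≢k)) (column≈0 (suc r))))

  det-scaledIdentity : ∀ {n} q (M : Matrix n) → (∀ i j → M i j ≈ q * δ i j) → det M ≈ q ^ n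
  det-scaledIdentity {zero}  q M M≈qI = refl
  det-scaledIdentity {suc n} q M M≈qI = begin
    det M                           ≈⟨ trans (det-expand M) (sum-single zero offDiagonal≈0) ⟩
    1# * M zero zero * det (minor M zero)
      ≈⟨ *-cong (trans (*-identityˡ _) (trans (M≈qI zero zero) (*-identityʳ q)))
                (det-scaledIdentity q (minor M zero)
                  (λ r s → trans (M≈qI (suc r) (suc s)) (reflexive (≡.cong (q *_) (δ-suc r s))))) ⟩
    q * q ^ n                       ∎
    where
    offDiagonal≈0 : ∀ j → j ≢ zero → laplaceTerm M j ≈ 0#
    offDiagonal≈0 zero    0≢0 = ⊥-elim (0≢0 ≡.refl)
    offDiagonal≈0 (suc j) _   = laplaceTerm-zeroEntry M (suc j) (trans (M≈qI zero (suc j)) (zeroʳ q))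

  -- The minor of an arrowhead matrix at position (0, j + 1).
  frontColumn : ∀ {m} → Fin (suc m) → (Fin (suc m) → Carrier) → Carrier → Matrix (suc m)
  frontColumn j v q r zero    = v r
  frontColumn j v q r (suc s) = q * δ r (punchIn j s)

  det-frontColumn : ∀ {m} j v q → det (frontColumn {m} j v q) ≈ sign (toℕ j) * (v j * q ^ m)
  det-frontColumn {m} zero v q = begin
    det M                              ≈⟨ trans (det-expand M) (sum-single zero others≈0) ⟩
    1# * v zero * det (minor M zero)
      ≈⟨ *-congˡ (det-scaledIdentity q (minor M zero) (λ r s → reflexive (≡.cong (q *_) (δ-suc r s)))) ⟩
    1# * v zero * q ^ m                ≈⟨ *-assoc 1# (v zero) (q ^ m) ⟩
    1# * (v zero * q ^ m)              ∎
    where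
    M = frontColumn zero v q
    others≈0 : ∀ k → k ≢ zero → laplaceTerm M k ≈ 0#
    others≈0 zero    0≢0 = ⊥-elim (0≢0 ≡.refl)
    others≈0 (suc k) _   = laplaceTerm-zeroEntry M (suc k) (zeroʳ q)
  det-frontColumn {suc m} (suc j) v q = begin
    det M                                          ≈⟨ trans (det-expand M) (sum-single (suc zero) others≈0) ⟩
    - 1# * (q * 1#) * det (minor M (suc zero))
      ≈⟨ *-cong (trans (-1*x≈-x _) (-‿cong (*-identityʳ q)))
                (trans (det-cong minor≈frontColumn) (det-frontColumn j (λ i → v (suc i)) q)) ⟩
    - q * (S * (V * q ^ m))                        ≈⟨ -‿distribˡ-* q _ ⟨
    - (q * (S * (V * q ^ m)))                      ≈⟨ -‿cong (regroup q S V (q ^ m)) ⟩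
    - (S * (V * (q * q ^ m)))                      ≈⟨ -‿distribˡ-* S _ ⟩
    - S * (V * (q * q ^ m))                        ∎
    where
    M = frontColumn (suc j) v q
    S = sign (toℕ j)
    V = v (suc j)
    others≈0 : ∀ k → k ≢ suc zero → laplaceTerm M k ≈ 0#
    others≈0 zero          _   = laplaceTerm-zeroMinor M zero (det-zeroColumn (minor M zero) zero (λ _ → zeroʳ q))
    others≈0 (suc zero)    1≢1 = ⊥-elim (1≢1 ≡.refl)
    others≈0 (suc (suc k)) _   = laplaceTerm-zeroEntry M (suc (suc k)) (zeroʳ q)
    minor≈frontColumn : ∀ r s → minor M (suc zero) r s ≈ frontColumn j (λ i → v (suc i)) q r s
    minor≈frontColumn r zero    = refl
    minor≈frontColumn r (suc s) = reflexive (≡.cong (q *_) (δ-suc r (punchIn j s)))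
    regroup : ∀ q S V Q → q * (S * (V * Q)) ≈ S * (V * (q * Q))
    regroup = solve 4 (λ q S V Q → q :* (S :* (V :* Q)) := S :* (V :* (q :* Q))) refl

  det-arrowhead : ∀ {m} (M : Matrix (suc (suc m))) {p q : Carrier} {u v : Fin (suc m) → Carrier} →
                  M zero zero ≈ p → (∀ j → M zero (suc j) ≈ u j) → (∀ i → M (suc i) zero ≈ v i) →
                  (∀ i j → M (suc i) (suc j) ≈ q * δ i j) →
                  det M ≈ p * q ^ suc m - q ^ m * sum (λ j → u j * v j)
  det-arrowhead {m} M {p} {q} {u} {v} corner row column block = begin
    det M                                                         ≈⟨ det-expand M ⟩
    laplaceTerm M zero + sum (λ j → laplaceTerm M (suc j))        ≈⟨ +-cong centreTerm (sum-cong-≋ leafTerm) ⟩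
    p * q ^ suc m + sum (λ j → - q ^ m * (u j * v j))             ≈⟨ +-congˡ (*-distribˡ-sum (- q ^ m) (λ j → u j * v j)) ⟨
    p * q ^ suc m + - q ^ m * sum (λ j → u j * v j)               ≈⟨ +-congˡ (-‿distribˡ-* (q ^ m) _) ⟨
    p * q ^ suc m - q ^ m * sum (λ j → u j * v j)                 ∎
    where
    centreTerm : laplaceTerm M zero ≈ p * q ^ suc m
    centreTerm = *-cong (trans (*-identityˡ _) corner) (det-scaledIdentity q (minor M zero) block)
    minor≈frontColumn : ∀ j r s → minor M (suc j) r s ≈ frontColumn j v q r s
    minor≈frontColumn j r zero    = column r
    minor≈frontColumn j r (suc s) = block r (punchIn j s)
    leafTerm : ∀ j → laplaceTerm M (suc j) ≈ - q ^ m * (u j * v j)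
    leafTerm j = begin
      sign (suc (toℕ j)) * M zero (suc j) * det (minor M (suc j))
        ≈⟨ *-cong (*-congˡ (row j)) (trans (det-cong (minor≈frontColumn j)) (det-frontColumn j v q)) ⟩
      sign (suc (toℕ j)) * u j * (sign (toℕ j) * (v j * q ^ m))   ≈⟨ sign-suc-*-sign (toℕ j) (u j) _ ⟩
      - (u j * (v j * q ^ m))                                     ≈⟨ -‿cong (regroup (u j) (v j) (q ^ m)) ⟩
      - (q ^ m * (u j * v j))                                     ≈⟨ -‿distribˡ-* (q ^ m) _ ⟩
      - q ^ m * (u j * v j)                                       ∎
      where
      regroup : ∀ u v Q → u * (v * Q) ≈ Q * (u * v)
      regroup = solve 3 (λ u v Q → u :* (v :* Q) := Q :* (u :* v)) refl

  charPoly-identity : ∀ n x → charPoly (δ {n}) x ≈ (x - 1#) ^ n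
  charPoly-identity n x = det-scaledIdentity {n} (x - 1#) _
    (λ i j → trans (+-congˡ (-‿cong (sym (*-identityˡ (δ i j))))) (sym ([y-z]x≈yx-zx (δ i j) x 1#)))

  identity-spectrum : ∀ n → IsSpectrum (δ {n}) (replicate n 1#)
  identity-spectrum zero    x = refl
  identity-spectrum (suc n) x =
    trans (charPoly-identity (suc n) x) (*-congˡ (trans (sym (charPoly-identity n x)) (identity-spectrum n x)))

  spectrum-of-factorisation : ∀ {n} (M : Matrix n) a b m →
    (∀ x → charPoly M x ≈ (x - a) * (x - b) * (x - 1#) ^ m) → IsSpectrum M (a ∷ b ∷ replicate m 1#)
  spectrum-of-factorisation M a b m factorisation x =
    trans (factorisation x)
          (trans (*-assoc _ _ _)
                 (*-congˡ (*-congˡ (trans (sym (charPoly-identity m x)) (identity-spectrum m x)))))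

module Homomorphism {c ℓ c' ℓ'} (R : CommutativeRing c ℓ) (S : CommutativeRing c' ℓ')
  {ι : CommutativeRing.Carrier R → CommutativeRing.Carrier S}
  (ι-hom : RingMorphisms.IsRingHomomorphism (CommutativeRing.rawRing R) (CommutativeRing.rawRing S) ι)
  where
  private
    module Rᵒ = RingOps R
    module R = CommutativeRing R
  open CommutativeRing S hiding (zero)
  open RingOps S
  open RingMorphisms.IsRingHomomorphism ι-hom public

  Σᶠ-homo : ∀ {n} {f : Fin n → R.Carrier} {g : Fin n → Carrier} → (∀ i → ι (f i) ≈ g i) → ι (Rᵒ.Σᶠ f) ≈ Σᶠ g
  Σᶠ-homo {zero}  f≈g = 0#-homo
  Σᶠ-homo {suc n} f≈g = trans (+-homo _ _) (+-cong (f≈g zero) (Σᶠ-homo (λ i → f≈g (suc i))))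

  sign-homo : ∀ k → ι (Rᵒ.sign k) ≈ sign k
  sign-homo zero    = 1#-homo
  sign-homo (suc k) = trans (-‿homo _) (-‿cong (sign-homo k))

  δ-homo : ∀ {n} (i j : Fin n) → ι (Rᵒ.δ i j) ≈ δ i j
  δ-homo i j with i ≟ᶠ j
  ... | yes _ = 1#-homo
  ... | no  _ = 0#-homo

  fromℕ-homo : ∀ k → ι (Rᵒ.fromℕ k) ≈ fromℕ k
  fromℕ-homo zero    = 0#-homo
  fromℕ-homo (suc k) = trans (+-homo _ _) (+-cong 1#-homo (fromℕ-homo k))

  det-homo : ∀ {n} (M : Rᵒ.Matrix n) → ι (Rᵒ.det M) ≈ det (λ i j → ι (M i j))
  det-homo {zero}  M = 1#-homo
  det-homo {suc n} M = Σᶠ-homo λ j →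
    trans (*-homo _ _) (*-cong (trans (*-homo _ (M zero j)) (*-congʳ (sign-homo (toℕ j))))
                               (det-homo (λ r s → M (suc r) (punchIn j s))))

module Star {c ℓ} (F : Field c ℓ) {f : InvolutiveAut F} {m : ℕ} (Φ : SkewGainGraph F (star (suc m)) f) where
  open Field F hiding (zero)
  open RingOps commRing
  open Determinant commRing using (δ-suc)
  open import Algebra.Properties.Ring ring using (-0#≈0#)
  open SimpleGraph (star (suc m)) using (degree; adj?)
  open SkewGainGraph Φ using (laplacian)

  degree-centre : degree zero ≡ suc m
  degree-centre = countDec-all (λ j → adj? zero (suc j)) (λ _ → tt)

  degree-leaf : ∀ i → degree (suc i) ≡ 1
  degree-leaf i = ≡.cong suc (countDec-none (λ j → adj? (suc i) (suc j)) (λ _ ()))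

  laplacian-centre : laplacian zero zero ≈ fromℕ (suc m)
  laplacian-centre = begin
    fromℕ (degree zero) * 1# - 0#  ≈⟨ +-cong (*-identityʳ _) -0#≈0# ⟩
    fromℕ (degree zero) + 0#       ≈⟨ +-identityʳ _ ⟩
    fromℕ (degree zero)            ≡⟨ ≡.cong fromℕ degree-centre ⟩
    fromℕ (suc m)                  ∎
    where open import Relation.Binary.Reasoning.Setoid setoid

  laplacian-leaves : ∀ i j → laplacian (suc i) (suc j) ≈ δ i j
  laplacian-leaves i j = begin
    fromℕ (degree (suc i)) * δ (suc i) (suc j) - 0#  ≈⟨ +-cong (*-congʳ (reflexive (≡.cong fromℕ (degree-leaf i)))) -0#≈0# ⟩
    (1# + 0#) * δ (suc i) (suc j) + 0#               ≈⟨ +-identityʳ _ ⟩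
    (1# + 0#) * δ (suc i) (suc j)                    ≈⟨ *-cong (+-identityʳ 1#) (reflexive (δ-suc i j)) ⟩
    1# * δ i j                                       ≈⟨ *-identityˡ (δ i j) ⟩
    δ i j                                            ∎
    where open import Relation.Binary.Reasoning.Setoid setoid

module StarCharPoly {c ℓ c' ℓ'} (F : Field c ℓ) {f : InvolutiveAut F} {m : ℕ}
  (Φ : SkewGainGraph F (star (suc m)) f) (E : AlgClosedExtension F c' ℓ') where
  private
    module Fᵒ = RingOps (Field.commRing F)
    L = SkewGainGraph.laplacian Φ
  open Star F Φ
  open AlgClosedExtension E using (K; ι; ι-hom)
  open Field K hiding (zero)
  open RingOps commRing
  open Determinant commRing
  open Quadratic commRing using (-x*-y≈x*y; vieta)
  open Homomorphism (Field.commRing F) commRing ι-hom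
  open import Algebra.Properties.Ring ring using ([y-z]x≈yx-zx)
  open import Algebra.Properties.Semiring.Sum semiring using (sum; sum-cong-≋)
  open import Relation.Binary.Reasoning.Setoid setoid

  Lι : Matrix (suc (suc m))
  Lι i j = ι (L i j)

  N D P T : Carrier
  N = ι (Fᵒ.fromℕ (suc (suc m)))
  D = ι (Fᵒ.det L)
  P = Lι zero zero
  T = sum (λ j → Lι zero (suc j) * Lι (suc j) zero)

  Lι-leaves : ∀ i j → Lι (suc i) (suc j) ≈ 1# * δ i j
  Lι-leaves i j = trans (⟦⟧-cong (laplacian-leaves i j)) (trans (δ-homo i j) (sym (*-identityˡ (δ i j))))

  P+1≈N : P + 1# ≈ N
  P+1≈N = begin
    P + 1#                        ≈⟨ +-comm P 1# ⟩
    1# + P                        ≈⟨ +-cong (sym 1#-homo) (⟦⟧-cong laplacian-centre) ⟩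
    ι (Field.1# F) + ι (Fᵒ.fromℕ (suc m))  ≈⟨ +-homo _ _ ⟨
    N                             ∎

  det-laplacian : D ≈ P - T
  det-laplacian = begin
    D                                 ≈⟨ det-homo L ⟩
    det Lι                            ≈⟨ det-arrowhead Lι refl (λ _ → refl) (λ _ → refl) Lι-leaves ⟩
    P * 1# ^ suc m - 1# ^ m * T       ≈⟨ +-cong (trans (*-congˡ (1#^n≈1# (suc m))) (*-identityʳ P))
                                                (-‿cong (trans (*-congʳ (1#^n≈1# m)) (*-identityˡ T))) ⟩
    P - T                             ∎

  charPoly-laplacian : ∀ x → charPoly Lι x ≈ (x * x - N * x + D) * (x - 1#) ^ m
  charPoly-laplacian x = begin
    charPoly Lι x                                   ≈⟨ det-arrowhead (λ i j → x * δ i j - Lι i j) corner row column block ⟩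
    (x - P) * ((x - 1#) * Q) - Q * sum (λ j → - Lι zero (suc j) * - Lι (suc j) zero)
      ≈⟨ +-congˡ (-‿cong (*-congˡ (sum-cong-≋ (λ j → -x*-y≈x*y (Lι zero (suc j)) (Lι (suc j) zero))))) ⟩
    (x - P) * ((x - 1#) * Q) - Q * T                ≈⟨ +-cong (*-assoc _ _ _) (-‿cong (*-comm T Q)) ⟨
    (x - P) * (x - 1#) * Q - T * Q                  ≈⟨ [y-z]x≈yx-zx Q _ T ⟨
    ((x - P) * (x - 1#) - T) * Q                    ≈⟨ *-congʳ (+-congʳ (vieta P+1≈N (*-identityʳ P))) ⟩
    (x * x - N * x + P - T) * Q                     ≈⟨ *-congʳ (trans (+-assoc _ _ _) (+-congˡ (sym det-laplacian))) ⟩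
    (x * x - N * x + D) * Q                         ∎
    where
    Q = (x - 1#) ^ m
    corner : x * 1# - P ≈ x - P
    corner = +-congʳ (*-identityʳ x)
    row : ∀ j → x * 0# - Lι zero (suc j) ≈ - Lι zero (suc j)
    row j = trans (+-congʳ (zeroʳ x)) (+-identityˡ _)
    column : ∀ i → x * 0# - Lι (suc i) zero ≈ - Lι (suc i) zero
    column i = trans (+-congʳ (zeroʳ x)) (+-identityˡ _)
    block : ∀ i j → x * δ (suc i) (suc j) - Lι (suc i) (suc j) ≈ (x - 1#) * δ i j
    block i j = trans (+-cong (*-congˡ (reflexive (δ-suc i j))) (-‿cong (Lι-leaves i j)))
                      (sym ([y-z]x≈yx-zx (δ i j) x 1#))

mainTheorem8 :
    ∀ {c ℓ c' ℓ' : Level} (F : Field c ℓ) → CharZero F →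
    (f : InvolutiveAut F) (n : ℕ) → 1 ≤ n →
    (Φ : SkewGainGraph F (star n) f) →
    (E : AlgClosedExtension F c' ℓ') →
    let K = AlgClosedExtension.K E
        ι = AlgClosedExtension.ι E
        L = SkewGainGraph.laplacian Φ
        detL = RingOps.det (Field.commRing F) L
        nF = RingOps.fromℕ (Field.commRing F)
        open Field K
    in (s : Carrier) →
       s * s ≈ ι (Field._-_ F (Field._*_ F (nF (suc n)) (nF (suc n)))
                              (Field._*_ F (nF 4) detL)) →
       (half : Carrier) → half * (1# + 1#) ≈ 1# →
       RingOps.IsSpectrum (Field.commRing K) (λ i j → ι (L i j))
         (((ι (nF (suc n)) + s) * half) ∷ ((ι (nF (suc n)) - s) * half) ∷ replicate (n ∸ 1) 1#)
mainTheorem8 F _ f (suc m) (s≤s z≤n) Φ E s s²≈disc half half-inverse =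
  spectrum-of-factorisation Lι _ _ m λ x →
    trans (charPoly-laplacian x) (*-congʳ (quadratic-splits s²≈N²-4D half-inverse))
  where
  open StarCharPoly F Φ E
  open Field (AlgClosedExtension.K E)
  open Determinant commRing using (spectrum-of-factorisation)
  open Quadratic commRing using (quadratic-splits)
  open RingOps commRing using (fromℕ)
  open Homomorphism (Field.commRing F) commRing (AlgClosedExtension.ι-hom E)
  s²≈N²-4D : s * s ≈ N * N - fromℕ 4 * D
  s²≈N²-4D = trans s²≈disc (trans (+-homo _ _) (+-cong (*-homo _ _)
    (trans (-‿homo _) (-‿cong (trans (*-homo _ _) (*-congʳ (fromℕ-homo 4)))))))
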